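{- Let $N\ge4$ and $J\subseteq[N]^2$. If $|J|>N(N-1)$, then $E_N(J)=2$.
   Context: $[n]=\{1,\dots,n\}$. Let ${\bf 1}_N$ be the all-ones vector in $\mathbb{R}^N$, ${\bf 0}_N$ the zero vector, and ${\mathbf e}_N(m)$ the $m$-th standard basis vector of $\mathbb{R}^N$. Let $D_1(N)=\{(i,j)\in[N]^2:i=j\}$ and $D_2(N)=\{(i,j)\in[N]^2:i+j=N+1\}$. For $(i,j)\in[N]^2$ define ${\mathbf d}_{i,j}\in\mathbb{Z}^{2N}$ (written as a pair of $N$-vectors, top then bottom) by: ${\mathbf d}_{i,j}=({\mathbf e}_N(i)-{\bf 1}_N,\ {\mathbf e}_N(j)-{\bf 1}_N)$ if $(i,j)\in D_1(N)\cap D_2(N)$; $({\mathbf e}_N(i)-{\bf 1}_N,\ {\mathbf e}_N(j))$ if $(i,j)\in D_1(N)\setminus D_2(N)$; $({\mathbf e}_N(i),\ {\mathbf e}_N(j)-{\bf 1}_N)$ if $(i,j)\in D_2(N)\setminus D_1(N)$; and $({\mathbf e}_N(i),\ {\mathbf e}_N(j))$ otherwise. For $J\subseteq[N]^2$, let $V_J$ be the span of $\{{\mathbf d}_{i,j}:(i,j)\in J\}$ and $E_N(J)=\dim\big(V_J\cap\mathrm{span}\{({\bf 1}_N,{\bf 0}_N),({\bf 0}_N,{\bf 1}_N)\}\big)$. -}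

module Defs where

open import Data.Nat using (ℕ; zero; suc; _+_; _∸_)
open import Data.Nat.Properties using () renaming (_≟_ to _≟ℕ_)
open import Data.Fin using (Fin; toℕ) renaming (zero to fz; suc to fs)
open import Data.Fin.Properties using () renaming (_≟_ to _≟F_)
open import Data.Bool using (Bool; true; false; if_then_else_)
open import Data.Product using (Σ; _×_; ∃)
open import Data.Rational using (ℚ; 0ℚ; 1ℚ) renaming (_+_ to _+ℚ_; _*_ to _*ℚ_; _-_ to _-ℚ_)
open import Relation.Nullary using (does)
open import Relation.Binary.PropositionalEquality using (_≡_)

Σℕ : ∀ {n} → (Fin n → ℕ) → ℕ
Σℕ {zero} f = 0
Σℕ {suc n} f = f fz + Σℕ (λ i → f (fs i))

Σℚ : ∀ {n} → (Fin n → ℚ) → ℚ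
Σℚ {zero} f = 0ℚ
Σℚ {suc n} f = f fz +ℚ Σℚ (λ i → f (fs i))

-- A subset J ⊆ [N]^2, given by its characteristic function (indices 0-based)
Subset² : ℕ → Set
Subset² N = Fin N → Fin N → Bool

card : ∀ {N} → Subset² N → ℕ
card J = Σℕ (λ i → Σℕ (λ j → if J i j then 1 else 0))

-- Vectors in ℚ^{2N}, written as (top, bottom) pair of N-vectors
Vec2 : ℕ → Set
Vec2 N = (Fin N → ℚ) × (Fin N → ℚ)

e : ∀ {N} → Fin N → Fin N → ℚ
e m k = if does (m ≟F k) then 1ℚ else 0ℚ

one : ∀ {N} → Fin N → ℚ
one k = 1ℚ

zer : ∀ {N} → Fin N → ℚ
zer k = 0ℚ

_⊖_ : ∀ {N} → (Fin N → ℚ) → (Fin N → ℚ) → Fin N → ℚ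
(u ⊖ v) k = u k -ℚ v k

-- membership in D₁(N) (i = j) and D₂(N) (i + j = N + 1, i.e. toℕ i + toℕ j = N - 1 for 0-based indices)
inD₁ : ∀ {N} → Fin N → Fin N → Bool
inD₁ i j = does (i ≟F j)

inD₂ : ∀ {N} → Fin N → Fin N → Bool
inD₂ {N} i j = does ((toℕ i + toℕ j) ≟ℕ (N ∸ 1))

d : ∀ {N} → Fin N → Fin N → Vec2 N
d i j with inD₁ i j | inD₂ i j
... | true  | true  = (e i ⊖ one) Data.Product., (e j ⊖ one)
... | true  | false = (e i ⊖ one) Data.Product., e j
... | false | true  = e i Data.Product., (e j ⊖ one)
... | false | false = e i Data.Product., e j

InSpan : ∀ {N} → Subset² N → Vec2 N → Set
InSpan {N} J (vt Data.Product., vb) =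
  Σ (Fin N → Fin N → ℚ) λ c →
    (∀ i j → J i j ≡ false → c i j ≡ 0ℚ) ×
    (∀ k → Σℚ (λ i → Σℚ (λ j → c i j *ℚ Data.Product.proj₁ (d i j) k)) ≡ vt k) ×
    (∀ k → Σℚ (λ i → Σℚ (λ j → c i j *ℚ Data.Product.proj₂ (d i j) k)) ≡ vb k)

-- E_N(J) = 2, i.e. V_J ∩ span{(1,0),(0,1)} is the whole 2-dimensional span{(1,0),(0,1)},
-- i.e. both (1_N, 0_N) and (0_N, 1_N) lie in V_J.
E≡2 : ∀ N → Subset² N → Set
E≡2 N J = InSpan J (one Data.Product., zer) × InSpan J (zer Data.Product., one)

-- Writing x′ for opposite x, the vector d_{i,j} equals (e_i − [i = j]·1, e_j − [i′ = j]·1), so for cells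
-- (a,s), (a,u), (c,s), (c,u) of J the combination d_{a,s} − d_{a,u} − d_{c,s} + d_{c,u} lies in
-- span{(1,0),(0,1)}: it is p(s) − p(u) for the point p(k) = ([c = k] − [a = k], [c′ = k] − [a′ = k]) of ℚ².
-- Counting shows that |J| > N(N−1) forces a full row a and, as N ≥ 4, a row c ∉ {a, a′} missing at most
-- one cell. Among a, a′, c, c′ (plus a column z outside them when a = a′ or c = c′) there are four columns
-- whose points are in general position; whichever column row c misses, three remain whose differences
-- span ℚ², and Cramer's rule puts (1,0) and (0,1) into V_J.
module Submission where

open import Data.Bool using (Bool; true; false; if_then_else_)
open import Data.Bool.Properties using (¬-not) renaming (_≟_ to _≟B_)
open import Data.Fin using (Fin; toℕ; opposite; punchIn; inject≤) renaming (zero to fz; suc to fs)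
open import Data.Fin.Patterns using (0F; 1F; 2F; 3F)
open import Data.Fin.Properties
  using (toℕ-injective; toℕ≤pred[n]; opposite-prop; opposite-involutive; punchInᵢ≢i; punchIn-injective;
         inject≤-injective; any?; all?; ¬∀⟶∃¬)
  renaming (_≟_ to _≟F_)
open import Data.Nat using (ℕ; zero; suc; _+_; _*_; _∸_; _≤_; _<_; z≤n; s≤s; ⌊_/2⌋)
import Data.Nat.Properties as ℕ
open import Algebra.Properties.CommutativeSemigroup ℕ.+-commutativeSemigroup using (interchange)
open import Data.Nat.Tactic.RingSolver using (solve-∀)
open import Data.Product using (_×_; _,_; proj₁; proj₂; ∃; ∃₂)
open import Data.Rational using (ℚ; 0ℚ; 1ℚ; 1/_; ≢-nonZero)
  renaming (_+_ to _+ℚ_; _*_ to _*ℚ_; _-_ to _-ℚ_; -_ to -ℚ_)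
import Data.Rational.Properties as ℚ
open import Data.Rational.Solver using (module +-*-Solver)
open import Data.Vec using (Vec; []; _∷_; lookup)
open import Data.Vec.Relation.Unary.All using (All; []; _∷_)
open import Data.Vec.Relation.Unary.All.Properties using (lookup⁻)
open import Data.Vec.Relation.Unary.AllPairs using ([]; _∷_)
open import Data.Vec.Relation.Unary.Unique.Propositional using (Unique)
open import Data.Vec.Relation.Unary.Unique.Propositional.Properties using (lookup-injective)
open import Function using (_∘_; Injective)
open import Relation.Binary.PropositionalEquality
open import Relation.Nullary using (Dec; does; yes; no; ¬_; contradiction)
open import Relation.Nullary.Decidable using (dec-true; dec-false; ¬?; _×-dec_)

open import Defs
open +-*-Solver

Σℚ-cong : ∀ {n} {f g : Fin n → ℚ} → (∀ i → f i ≡ g i) → Σℚ f ≡ Σℚ g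
Σℚ-cong {zero} f≗g = refl
Σℚ-cong {suc n} f≗g = cong₂ _+ℚ_ (f≗g fz) (Σℚ-cong (λ i → f≗g (fs i)))

Σℚ-zero : ∀ {n} {f : Fin n → ℚ} → (∀ i → f i ≡ 0ℚ) → Σℚ f ≡ 0ℚ
Σℚ-zero {zero} f≗0 = refl
Σℚ-zero {suc n} f≗0 = cong₂ _+ℚ_ (f≗0 fz) (Σℚ-zero (λ i → f≗0 (fs i)))

Σℚ-linear : ∀ {n} (α β : ℚ) (f g : Fin n → ℚ) →
  Σℚ (λ i → α *ℚ f i +ℚ β *ℚ g i) ≡ α *ℚ Σℚ f +ℚ β *ℚ Σℚ g
Σℚ-linear {zero} α β f g = solve 2 (λ α β → con 0ℚ := α :* con 0ℚ :+ β :* con 0ℚ) refl α β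
Σℚ-linear {suc n} α β f g = begin
  α *ℚ f fz +ℚ β *ℚ g fz +ℚ Σℚ (λ i → α *ℚ f (fs i) +ℚ β *ℚ g (fs i))
    ≡⟨ cong (α *ℚ f fz +ℚ β *ℚ g fz +ℚ_) (Σℚ-linear α β (λ i → f (fs i)) (λ i → g (fs i))) ⟩
  α *ℚ f fz +ℚ β *ℚ g fz +ℚ (α *ℚ Σℚ (λ i → f (fs i)) +ℚ β *ℚ Σℚ (λ i → g (fs i)))
    ≡⟨ solve 6 (λ α β x y s t → α :* x :+ β :* y :+ (α :* s :+ β :* t) := α :* (x :+ s) :+ β :* (y :+ t))
         refl α β (f fz) (g fz) (Σℚ (λ i → f (fs i))) (Σℚ (λ i → g (fs i))) ⟩
  α *ℚ Σℚ f +ℚ β *ℚ Σℚ g ∎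
  where open ≡-Reasoning

Σℚ-e : ∀ {n} (p : Fin n) (f : Fin n → ℚ) → Σℚ (λ i → e p i *ℚ f i) ≡ f p
Σℚ-e fz f = begin
  1ℚ *ℚ f fz +ℚ Σℚ (λ i → 0ℚ *ℚ f (fs i))
    ≡⟨ cong₂ _+ℚ_ (ℚ.*-identityˡ (f fz)) (Σℚ-zero (λ i → ℚ.*-zeroˡ (f (fs i)))) ⟩
  f fz +ℚ 0ℚ
    ≡⟨ ℚ.+-identityʳ (f fz) ⟩
  f fz ∎
  where open ≡-Reasoning
Σℚ-e (fs p) f = begin
  0ℚ *ℚ f fz +ℚ Σℚ (λ i → e p i *ℚ f (fs i))
    ≡⟨ cong₂ _+ℚ_ (ℚ.*-zeroˡ (f fz)) (Σℚ-e p (λ i → f (fs i))) ⟩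
  0ℚ +ℚ f (fs p)
    ≡⟨ ℚ.+-identityˡ (f (fs p)) ⟩
  f (fs p) ∎
  where open ≡-Reasoning

combination : ∀ {N} → (Fin N → Fin N → ℚ) → (Fin N → Fin N → ℚ) → ℚ
combination c x = Σℚ (λ i → Σℚ (λ j → c i j *ℚ x i j))

combination-linear : ∀ {N} (α β : ℚ) (c c′ x : Fin N → Fin N → ℚ) →
  combination (λ i j → α *ℚ c i j +ℚ β *ℚ c′ i j) x ≡ α *ℚ combination c x +ℚ β *ℚ combination c′ x
combination-linear α β c c′ x = trans
  (Σℚ-cong λ i → trans
    (Σℚ-cong λ j → solve 5 (λ α β u v w → (α :* u :+ β :* v) :* w := α :* (u :* w) :+ β :* (v :* w))
                     refl α β (c i j) (c′ i j) (x i j))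
    (Σℚ-linear α β (λ j → c i j *ℚ x i j) (λ j → c′ i j *ℚ x i j)))
  (Σℚ-linear α β (λ i → Σℚ (λ j → c i j *ℚ x i j)) (λ i → Σℚ (λ j → c′ i j *ℚ x i j)))

combination-unit : ∀ {N} (p q : Fin N) (x : Fin N → Fin N → ℚ) →
  combination (λ i j → e p i *ℚ e q j) x ≡ x p q
combination-unit p q x = trans
  (Σℚ-cong λ i → trans
    (Σℚ-cong λ j → solve 3 (λ u v w → (u :* v) :* w := v :* (u :* w)) refl (e p i) (e q j) (x i j))
    (Σℚ-e q (λ j → e p i *ℚ x i j)))
  (Σℚ-e p (λ i → x i q))

lincomb : ∀ {N} → ℚ → Vec2 N → ℚ → Vec2 N → Vec2 N
lincomb α (ut , ub) β (vt , vb) = (λ k → α *ℚ ut k +ℚ β *ℚ vt k) , (λ k → α *ℚ ub k +ℚ β *ℚ vb k)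

_−²_ : ∀ {N} → Vec2 N → Vec2 N → Vec2 N
u −² v = lincomb 1ℚ u (-ℚ 1ℚ) v

InSpan-lincomb : ∀ {N} (J : Subset² N) (α β : ℚ) {u v : Vec2 N} →
  InSpan J u → InSpan J v → InSpan J (lincomb α u β v)
InSpan-lincomb J α β (c , c-out , c-top , c-bot) (c′ , c′-out , c′-top , c′-bot) =
  (λ i j → α *ℚ c i j +ℚ β *ℚ c′ i j) ,
  (λ i j ij∉J → trans (cong₂ (λ s t → α *ℚ s +ℚ β *ℚ t) (c-out i j ij∉J) (c′-out i j ij∉J))
                     (solve 2 (λ α β → α :* con 0ℚ :+ β :* con 0ℚ := con 0ℚ) refl α β)) ,
  (λ k → trans (combination-linear α β c c′ _) (cong₂ (λ s t → α *ℚ s +ℚ β *ℚ t) (c-top k) (c′-top k))) ,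
  (λ k → trans (combination-linear α β c c′ _) (cong₂ (λ s t → α *ℚ s +ℚ β *ℚ t) (c-bot k) (c′-bot k)))

InSpan-≗ : ∀ {N} (J : Subset² N) {ut ub vt vb : Fin N → ℚ} →
  (∀ k → ut k ≡ vt k) → (∀ k → ub k ≡ vb k) → InSpan J (ut , ub) → InSpan J (vt , vb)
InSpan-≗ J top bot (c , c-out , c-top , c-bot) =
  c , c-out , (λ k → trans (c-top k) (top k)) , (λ k → trans (c-bot k) (bot k))

InSpan-d : ∀ {N} (J : Subset² N) {p q : Fin N} → J p q ≡ true → InSpan J (d p q)
InSpan-d J {p} {q} pq∈J =
  (λ i j → e p i *ℚ e q j) , unit-out ,
  (λ k → combination-unit p q (λ i j → proj₁ (d i j) k)) ,
  (λ k → combination-unit p q (λ i j → proj₂ (d i j) k))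
  where
  unit-out : ∀ i j → J i j ≡ false → e p i *ℚ e q j ≡ 0ℚ
  unit-out i j ij∉J with p ≟F i
  ... | no _ = ℚ.*-zeroˡ (e q j)
  ... | yes refl with q ≟F j
  ...   | no _ = ℚ.*-zeroʳ 1ℚ
  ...   | yes refl with () ← trans (sym pq∈J) ij∉J

toℕ+toℕ-opposite : ∀ {N} (i : Fin N) → toℕ i + toℕ (opposite i) ≡ N ∸ 1
toℕ+toℕ-opposite {suc n} i = trans (cong (toℕ i +_) (opposite-prop i)) (ℕ.m+[n∸m]≡n (toℕ≤pred[n] i))

inD₂≡inD₁∘opposite : ∀ {N} (i j : Fin N) → inD₂ i j ≡ inD₁ (opposite i) j
inD₂≡inD₁∘opposite i j with opposite i ≟F j
... | yes refl = dec-true (_ ℕ.≟ _) (toℕ+toℕ-opposite i)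
... | no i′≢j  = dec-false (_ ℕ.≟ _) λ i+j≡N-1 →
  i′≢j (toℕ-injective (ℕ.+-cancelˡ-≡ (toℕ i) _ _ (trans (toℕ+toℕ-opposite i) (sym i+j≡N-1))))

opposite-injective : ∀ {n} {i j : Fin n} → opposite i ≡ opposite j → i ≡ j
opposite-injective {i = i} {j} i′≡j′ =
  trans (sym (opposite-involutive i)) (trans (cong opposite i′≡j′) (opposite-involutive j))

opposite-transpose : ∀ {n} {i j : Fin n} → opposite i ≡ j → i ≡ opposite j
opposite-transpose {i = i} refl = sym (opposite-involutive i)

opposite-fixed-unique : ∀ {N} {i j : Fin N} → opposite i ≡ i → opposite j ≡ j → i ≡ j
opposite-fixed-unique {N} {i} {j} i′≡i j′≡j = toℕ-injective (begin
  toℕ i                   ≡⟨ ℕ.n≡⌊n+n/2⌋ (toℕ i) ⟩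
  ⌊ toℕ i + toℕ i /2⌋     ≡⟨ cong ⌊_/2⌋ (trans (double≡N-1 i i′≡i) (sym (double≡N-1 j j′≡j))) ⟩
  ⌊ toℕ j + toℕ j /2⌋     ≡⟨ ℕ.n≡⌊n+n/2⌋ (toℕ j) ⟨
  toℕ j                   ∎)
  where
  open ≡-Reasoning
  double≡N-1 : ∀ x → opposite x ≡ x → toℕ x + toℕ x ≡ N ∸ 1
  double≡N-1 x x′≡x = subst (λ y → toℕ x + toℕ y ≡ N ∸ 1) x′≡x (toℕ+toℕ-opposite x)

d-top : ∀ {N} (i j k : Fin N) → proj₁ (d i j) k ≡ e i k -ℚ e i j
d-top i j k with inD₁ i j | inD₂ i j
... | true  | true  = refl
... | true  | false = refl
... | false | true  = sym (ℚ.+-identityʳ (e i k))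
... | false | false = sym (ℚ.+-identityʳ (e i k))

d-bot : ∀ {N} (i j k : Fin N) → proj₂ (d i j) k ≡ e j k -ℚ e (opposite i) j
d-bot i j k rewrite sym (inD₂≡inD₁∘opposite i j) with inD₁ i j | inD₂ i j
... | true  | true  = refl
... | true  | false = sym (ℚ.+-identityʳ (e j k))
... | false | true  = refl
... | false | false = sym (ℚ.+-identityʳ (e j k))

Point : Set
Point = ℚ × ℚ

embed : ∀ {N} → Point → Vec2 N
embed (x , y) = (λ _ → x) , (λ _ → y)

_−ᵖ_ : Point → Point → Point
(x , y) −ᵖ (x′ , y′) = x -ℚ x′ , y -ℚ y′

det : Point → Point → ℚ
det (x , y) (x′ , y′) = x *ℚ y′ -ℚ y *ℚ x′

AffinelyIndependent : (Fin 3 → Point) → Set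
AffinelyIndependent p = det (p 0F −ᵖ p 2F) (p 1F −ᵖ p 2F) ≢ 0ℚ

InGeneralPosition : (Fin 4 → Point) → Set
InGeneralPosition p = ∀ m → AffinelyIndependent (p ∘ punchIn m)

profile : ∀ {n} (a c a′ c′ k : Fin n) → Point
profile a c a′ c′ k = e c k -ℚ e a k , e c′ k -ℚ e a′ k

e-injective : ∀ {m n} {κ : Fin m → Fin n} → Injective _≡_ _≡_ κ → ∀ i j → e (κ i) (κ j) ≡ e i j
e-injective {κ = κ} κ-inj i j with κ i ≟F κ j | i ≟F j
... | yes _     | yes _    = refl
... | no _      | no _     = refl
... | yes κi≡κj | no i≢j   = contradiction (κ-inj κi≡κj) i≢j
... | no κi≢κj  | yes refl = contradiction refl κi≢κj

profile-injective : ∀ {m n} {κ : Fin m → Fin n} → Injective _≡_ _≡_ κ → ∀ α γ α′ γ′ i →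
  profile (κ α) (κ γ) (κ α′) (κ γ′) (κ i) ≡ profile α γ α′ γ′ i
profile-injective κ-inj α γ α′ γ′ i =
  cong₂ _,_ (cong₂ _-ℚ_ (e-injective κ-inj γ i) (e-injective κ-inj α i))
            (cong₂ _-ℚ_ (e-injective κ-inj γ′ i) (e-injective κ-inj α′ i))

-- Each suffix lists the columns xs used in E≡2-from-full-row, z being a column outside {a, a′, c, c′}.
inGeneralPosition-aa′cc′ : InGeneralPosition (profile 0F 2F 1F 3F)
inGeneralPosition-aa′cc′ 0F ()
inGeneralPosition-aa′cc′ 1F ()
inGeneralPosition-aa′cc′ 2F ()
inGeneralPosition-aa′cc′ 3F ()

inGeneralPosition-zacc′ : InGeneralPosition (profile 1F 2F 1F 3F)
inGeneralPosition-zacc′ 0F ()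
inGeneralPosition-zacc′ 1F ()
inGeneralPosition-zacc′ 2F ()
inGeneralPosition-zacc′ 3F ()

inGeneralPosition-zaa′c : InGeneralPosition (profile 1F 3F 2F 3F)
inGeneralPosition-zaa′c 0F ()
inGeneralPosition-zaa′c 1F ()
inGeneralPosition-zaa′c 2F ()
inGeneralPosition-zaa′c 3F ()

rectangle : ∀ {N} (J : Subset² N) {a c s u : Fin N} →
  J a s ≡ true → J a u ≡ true → J c s ≡ true → J c u ≡ true →
  InSpan J (embed (profile a c (opposite a) (opposite c) s −ᵖ profile a c (opposite a) (opposite c) u))
rectangle J {a} {c} {s} {u} as∈J au∈J cs∈J cu∈J = InSpan-≗ J top bot
  ((InSpan-d J as∈J −ˢ InSpan-d J au∈J) −ˢ (InSpan-d J cs∈J −ˢ InSpan-d J cu∈J))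
  where
  _−ˢ_ : ∀ {v w} → InSpan J v → InSpan J w → InSpan J (v −² w)
  v∈V −ˢ w∈V = InSpan-lincomb J 1ℚ (-ℚ 1ℚ) v∈V w∈V
  top : ∀ k → proj₁ ((d a s −² d a u) −² (d c s −² d c u)) k ≡ (e c s -ℚ e a s) -ℚ (e c u -ℚ e a u)
  top k rewrite d-top a s k | d-top a u k | d-top c s k | d-top c u k =
    solve 6 (λ A C As Au Cs Cu →
      con 1ℚ :* (con 1ℚ :* (A :- As) :+ con (-ℚ 1ℚ) :* (A :- Au)) :+
      con (-ℚ 1ℚ) :* (con 1ℚ :* (C :- Cs) :+ con (-ℚ 1ℚ) :* (C :- Cu)) := (Cs :- As) :- (Cu :- Au))
      refl (e a k) (e c k) (e a s) (e a u) (e c s) (e c u)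
  bot : ∀ k → proj₂ ((d a s −² d a u) −² (d c s −² d c u)) k ≡
              (e (opposite c) s -ℚ e (opposite a) s) -ℚ (e (opposite c) u -ℚ e (opposite a) u)
  bot k rewrite d-bot a s k | d-bot a u k | d-bot c s k | d-bot c u k =
    solve 6 (λ S U As Au Cs Cu →
      con 1ℚ :* (con 1ℚ :* (S :- As) :+ con (-ℚ 1ℚ) :* (U :- Au)) :+
      con (-ℚ 1ℚ) :* (con 1ℚ :* (S :- Cs) :+ con (-ℚ 1ℚ) :* (U :- Cu)) := (Cs :- As) :- (Cu :- Au))
      refl (e s k) (e u k) (e (opposite a) s) (e (opposite a) u) (e (opposite c) s) (e (opposite c) u)

E≡2-from-det : ∀ {N} (J : Subset² N) (p q : Point) →
  InSpan J (embed p) → InSpan J (embed q) → det p q ≢ 0ℚ → E≡2 N J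
E≡2-from-det J (p₁ , p₂) (q₁ , q₂) p∈V q∈V D≢0 =
  InSpan-≗ J (λ _ → unit₁) (λ _ → zero₂) (InSpan-lincomb J (q₂ *ℚ r) (-ℚ (p₂ *ℚ r)) p∈V q∈V) ,
  InSpan-≗ J (λ _ → zero₁) (λ _ → unit₂) (InSpan-lincomb J (-ℚ (q₁ *ℚ r)) (p₁ *ℚ r) p∈V q∈V)
  where
  D = det (p₁ , p₂) (q₁ , q₂)
  r = (1/ D) {{≢-nonZero D≢0}}
  D*r≡1 : D *ℚ r ≡ 1ℚ
  D*r≡1 = ℚ.*-inverseʳ D {{≢-nonZero D≢0}}
  unit₁ : q₂ *ℚ r *ℚ p₁ +ℚ -ℚ (p₂ *ℚ r) *ℚ q₁ ≡ 1ℚ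
  unit₁ = trans (solve 5 (λ p₁ p₂ q₁ q₂ r → q₂ :* r :* p₁ :+ :- (p₂ :* r) :* q₁ := (p₁ :* q₂ :- p₂ :* q₁) :* r)
                  refl p₁ p₂ q₁ q₂ r) D*r≡1
  unit₂ : -ℚ (q₁ *ℚ r) *ℚ p₂ +ℚ p₁ *ℚ r *ℚ q₂ ≡ 1ℚ
  unit₂ = trans (solve 5 (λ p₁ p₂ q₁ q₂ r → :- (q₁ :* r) :* p₂ :+ p₁ :* r :* q₂ := (p₁ :* q₂ :- p₂ :* q₁) :* r)
                  refl p₁ p₂ q₁ q₂ r) D*r≡1
  zero₁ : -ℚ (q₁ *ℚ r) *ℚ p₁ +ℚ p₁ *ℚ r *ℚ q₁ ≡ 0ℚ
  zero₁ = solve 3 (λ p₁ q₁ r → :- (q₁ :* r) :* p₁ :+ p₁ :* r :* q₁ := con 0ℚ) refl p₁ q₁ r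
  zero₂ : q₂ *ℚ r *ℚ p₂ +ℚ -ℚ (p₂ *ℚ r) *ℚ q₂ ≡ 0ℚ
  zero₂ = solve 3 (λ p₂ q₂ r → q₂ :* r :* p₂ :+ :- (p₂ :* r) :* q₂ := con 0ℚ) refl p₂ q₂ r

E≡2-from-triangle : ∀ {N} (J : Subset² N) {a c : Fin N} (q : Fin 3 → Fin N) (p : Fin 3 → Point) →
  (∀ i → J a (q i) ≡ true) → (∀ i → J c (q i) ≡ true) →
  (∀ i → profile a c (opposite a) (opposite c) (q i) ≡ p i) → AffinelyIndependent p → E≡2 N J
E≡2-from-triangle J q p aq∈J cq∈J q↦p indep =
  E≡2-from-det J (p 0F −ᵖ p 2F) (p 1F −ᵖ p 2F) (edge 0F) (edge 1F) indep
  where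
  edge : ∀ i → InSpan J (embed (p i −ᵖ p 2F))
  edge i = subst (InSpan J ∘ embed) (cong₂ _−ᵖ_ (q↦p i) (q↦p 2F))
                 (rectangle J (aq∈J i) (aq∈J 2F) (cq∈J i) (cq∈J 2F))

punchIn-avoiding : ∀ {k N} (κ : Fin (suc k) → Fin N) → Injective _≡_ _≡_ κ → (h : Fin N) →
  ∃ λ m → ∀ j → κ (punchIn m j) ≢ h
punchIn-avoiding κ κ-inj h with any? (λ m → κ m ≟F h)
... | yes (m , κm≡h) = m , λ j κj≡h → punchInᵢ≢i m j (κ-inj (trans κj≡h (sym κm≡h)))
... | no ∄m          = 0F , λ j κj≡h → ∄m (punchIn 0F j , κj≡h)

injection-avoiding : ∀ {k N} (κ : Fin (suc k) → Fin N) → Injective _≡_ _≡_ κ → (hs : Fin k → Fin N) →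
  ∃ λ i → ∀ j → κ i ≢ hs j
injection-avoiding {zero} κ κ-inj hs = fz , λ ()
injection-avoiding {suc k} κ κ-inj hs with m , avoids-h₀ ← punchIn-avoiding κ κ-inj (hs fz)
  with i , avoids-rest ← injection-avoiding (κ ∘ punchIn m) (punchIn-injective m _ _ ∘ κ-inj) (hs ∘ fs)
  = punchIn m i , λ { fz → avoids-h₀ i ; (fs j) → avoids-rest j }

fresh : ∀ {k N} → k < N → (xs : Vec (Fin N) k) → ∃ λ z → All (z ≢_) xs
fresh k<N xs with i , avoids ← injection-avoiding (λ i → inject≤ i k<N) (inject≤-injective _ _ _ _) (lookup xs)
  = inject≤ i k<N , lookup⁻ avoids

AtMostOneHole : ∀ {N} → (Fin N → Bool) → Set
AtMostOneHole row = ∃ λ h → ∀ j → j ≢ h → row j ≡ true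

E≡2-from-quadrilateral : ∀ {N} (J : Subset² N) {a c : Fin N} (xs : Vec (Fin N) 4) (p : Fin 4 → Point) →
  Unique xs → (∀ j → J a j ≡ true) → AtMostOneHole (J c) →
  (∀ i → profile a c (opposite a) (opposite c) (lookup xs i) ≡ p i) → InGeneralPosition p → E≡2 N J
E≡2-from-quadrilateral J xs p xs-unique a-full (h , c-full-off-h) xs↦p general
  with m , avoids-h ← punchIn-avoiding (lookup xs) (lookup-injective xs-unique _ _) h
  = E≡2-from-triangle J (lookup xs ∘ punchIn m) (p ∘ punchIn m)
      (a-full ∘ lookup xs ∘ punchIn m) (λ i → c-full-off-h _ (avoids-h i)) (xs↦p ∘ punchIn m) (general m)

E≡2-from-labelled-columns : ∀ {N} (J : Subset² N) {a c : Fin N} (xs : Vec (Fin N) 4) (α γ α′ γ′ : Fin 4) →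
  Unique xs → lookup xs α ≡ a → lookup xs γ ≡ c → lookup xs α′ ≡ opposite a → lookup xs γ′ ≡ opposite c →
  InGeneralPosition (profile α γ α′ γ′) → (∀ j → J a j ≡ true) → AtMostOneHole (J c) → E≡2 N J
E≡2-from-labelled-columns J xs α γ α′ γ′ xs-unique refl refl α′↦a′ γ′↦c′ general a-full c-hole =
  E≡2-from-quadrilateral J xs (profile α γ α′ γ′) xs-unique a-full c-hole xs↦p general
  where
  xs↦p : ∀ i → profile (lookup xs α) (lookup xs γ) (opposite (lookup xs α)) (opposite (lookup xs γ)) (lookup xs i)
                ≡ profile α γ α′ γ′ i
  xs↦p i rewrite sym α′↦a′ | sym γ′↦c′ = profile-injective (lookup-injective xs-unique _ _) α γ α′ γ′ i

E≡2-from-full-row : ∀ {N} (J : Subset² N) {a c : Fin N} → 4 ≤ N →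
  (∀ j → J a j ≡ true) → c ≢ a → c ≢ opposite a → AtMostOneHole (J c) → E≡2 N J
E≡2-from-full-row {N} J {a} {c} 4≤N a-full c≢a c≢a′ c-hole = cases (opposite a ≟F a) (opposite c ≟F c)
  where
  a≢c : a ≢ c
  a≢c = c≢a ∘ sym
  a≢c′ : a ≢ opposite c
  a≢c′ = c≢a′ ∘ opposite-transpose ∘ sym
  a′≢c : opposite a ≢ c
  a′≢c = c≢a′ ∘ sym
  a′≢c′ : opposite a ≢ opposite c
  a′≢c′ = a≢c ∘ opposite-injective
  cases : Dec (opposite a ≡ a) → Dec (opposite c ≡ c) → E≡2 N J
  cases (yes a′≡a) (yes c′≡c) = contradiction (opposite-fixed-unique c′≡c a′≡a) c≢a
  cases (no a′≢a) (no c′≢c) =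
    E≡2-from-labelled-columns J (a ∷ opposite a ∷ c ∷ opposite c ∷ []) 0F 2F 1F 3F
      ((a′≢a ∘ sym ∷ a≢c ∷ a≢c′ ∷ []) ∷ (a′≢c ∷ a′≢c′ ∷ []) ∷ (c′≢c ∘ sym ∷ []) ∷ [] ∷ [])
      refl refl refl refl inGeneralPosition-aa′cc′ a-full c-hole
  cases (yes a′≡a) (no c′≢c) = let z , z-fresh = fresh 4≤N (a ∷ c ∷ opposite c ∷ []) in
    E≡2-from-labelled-columns J (z ∷ a ∷ c ∷ opposite c ∷ []) 1F 2F 1F 3F
      (z-fresh ∷ (a≢c ∷ a≢c′ ∷ []) ∷ (c′≢c ∘ sym ∷ []) ∷ [] ∷ [])
      refl refl (sym a′≡a) refl inGeneralPosition-zacc′ a-full c-hole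
  cases (no a′≢a) (yes c′≡c) = let z , z-fresh = fresh 4≤N (a ∷ opposite a ∷ c ∷ []) in
    E≡2-from-labelled-columns J (z ∷ a ∷ opposite a ∷ c ∷ []) 1F 3F 2F 3F
      (z-fresh ∷ (a′≢a ∘ sym ∷ a≢c ∷ []) ∷ (a′≢c ∷ []) ∷ [] ∷ [])
      refl refl refl (sym c′≡c) inGeneralPosition-zaa′c a-full c-hole

Σℕ-mono-≤ : ∀ {n} {f g : Fin n → ℕ} → (∀ i → f i ≤ g i) → Σℕ f ≤ Σℕ g
Σℕ-mono-≤ {zero} f≤g = z≤n
Σℕ-mono-≤ {suc n} f≤g = ℕ.+-mono-≤ (f≤g fz) (Σℕ-mono-≤ (f≤g ∘ fs))

Σℕ-const : ∀ n (k : ℕ) → Σℕ {n} (λ _ → k) ≡ n * k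
Σℕ-const zero k = refl
Σℕ-const (suc n) k = cong (k +_) (Σℕ-const n k)

Σℕ-distrib-+ : ∀ {n} (f g : Fin n → ℕ) → Σℕ (λ i → f i + g i) ≡ Σℕ f + Σℕ g
Σℕ-distrib-+ {zero} f g = refl
Σℕ-distrib-+ {suc n} f g = begin
  f fz + g fz + Σℕ (λ i → f (fs i) + g (fs i)) ≡⟨ cong (f fz + g fz +_) (Σℕ-distrib-+ (f ∘ fs) (g ∘ fs)) ⟩
  f fz + g fz + (Σℕ (f ∘ fs) + Σℕ (g ∘ fs))   ≡⟨ interchange (f fz) (g fz) (Σℕ (f ∘ fs)) (Σℕ (g ∘ fs)) ⟩
  f fz + Σℕ (f ∘ fs) + (g fz + Σℕ (g ∘ fs))   ∎
  where open ≡-Reasoning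

Σℕ-indicator : ∀ {n} (p : Fin n) (k : ℕ) → Σℕ (λ i → if does (p ≟F i) then k else 0) ≡ k
Σℕ-indicator {suc n} fz k = trans (cong (k +_) (Σℕ-const n 0)) (trans (cong (k +_) (ℕ.*-zeroʳ n)) (ℕ.+-identityʳ k))
Σℕ-indicator (fs p) k = Σℕ-indicator p k

rowCount : ∀ {N} → (Fin N → Bool) → ℕ
rowCount row = Σℕ (λ j → if row j then 1 else 0)

rowCount-≤ : ∀ {N} (row : Fin N → Bool) → rowCount row ≤ N
rowCount-≤ {zero} row = z≤n
rowCount-≤ {suc n} row with row fz
... | true  = s≤s (rowCount-≤ (row ∘ fs))
... | false = ℕ.m≤n⇒m≤1+n (rowCount-≤ (row ∘ fs))

rowCount-hole : ∀ {N} (row : Fin N → Bool) {j : Fin N} → row j ≡ false → rowCount row < N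
rowCount-hole row {fz} row0≡false rewrite row0≡false = s≤s (rowCount-≤ (row ∘ fs))
rowCount-hole row {fs j} rowj≡false with row fz
... | true  = s≤s (rowCount-hole (row ∘ fs) rowj≡false)
... | false = ℕ.m≤n⇒m≤1+n (rowCount-hole (row ∘ fs) rowj≡false)

rowCount-two-holes : ∀ {N} (row : Fin N → Bool) {j j′ : Fin N} →
  j ≢ j′ → row j ≡ false → row j′ ≡ false → 2 + rowCount row ≤ N
rowCount-two-holes row {fz} {fz} j≢j′ _ _ = contradiction refl j≢j′
rowCount-two-holes row {fz} {fs j′} _ row0≡false rowj′≡false rewrite row0≡false =
  s≤s (rowCount-hole (row ∘ fs) rowj′≡false)
rowCount-two-holes row {fs j} {fz} _ rowj≡false row0≡false rewrite row0≡false =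
  s≤s (rowCount-hole (row ∘ fs) rowj≡false)
rowCount-two-holes row {fs j} {fs j′} j≢j′ rowj≡false rowj′≡false with row fz
... | true  = s≤s (rowCount-two-holes (row ∘ fs) (j≢j′ ∘ cong fs) rowj≡false rowj′≡false)
... | false = ℕ.m≤n⇒m≤1+n (rowCount-two-holes (row ∘ fs) (j≢j′ ∘ cong fs) rowj≡false rowj′≡false)

TwoHoles : ∀ {N} → (Fin N → Bool) → Set
TwoHoles row = ∃₂ λ j j′ → j ≢ j′ × row j ≡ false × row j′ ≡ false

twoHoles? : ∀ {N} (row : Fin N → Bool) → Dec (TwoHoles row)
twoHoles? row = any? λ j → any? λ j′ → ¬? (j ≟F j′) ×-dec row j ≟B false ×-dec row j′ ≟B false

¬twoHoles⇒atMostOneHole : ∀ {n} (row : Fin (suc n) → Bool) → ¬ TwoHoles row → AtMostOneHole row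
¬twoHoles⇒atMostOneHole row ¬two with any? (λ j → row j ≟B false)
... | yes (h , rowh≡false) = h , λ j j≢h → ¬-not λ rowj≡false → ¬two (j , h , j≢h , rowj≡false , rowh≡false)
... | no ∄hole             = fz , λ j _ → ¬-not λ rowj≡false → ∄hole (j , rowj≡false)

full-row-exists : ∀ {N} (J : Subset² N) → N * (N ∸ 1) < card J → ∃ λ a → ∀ j → J a j ≡ true
full-row-exists {N} J large with any? (λ a → all? (λ j → J a j ≟B true))
... | yes full  = full
... | no ∄full = contradiction card≤ (ℕ.<⇒≱ large)
  where
  row-bound : ∀ a → rowCount (J a) ≤ N ∸ 1
  row-bound a = let j , Jaj≢true = ¬∀⟶∃¬ N _ (λ j → J a j ≟B true) (λ a-full → ∄full (a , a-full)) in
    ℕ.∸-monoˡ-≤ 1 (rowCount-hole (J a) (¬-not Jaj≢true))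
  card≤ : card J ≤ N * (N ∸ 1)
  card≤ = ℕ.≤-trans (Σℕ-mono-≤ row-bound) (ℕ.≤-reflexive (Σℕ-const N (N ∸ 1)))

too-many-cells : ∀ n m → 3 ≤ n → suc n * n < m → ¬ (suc n * 2 + m ≤ suc n * suc n + 4)
too-many-cells n m 3≤n large bound = ℕ.<⇒≱ (s≤s (s≤s 3≤n)) (ℕ.+-cancelˡ-≤ (suc n + suc n * n) (2 + n) 4 (begin
  suc n + suc n * n + (2 + n) ≡⟨ expand-lhs n ⟩
  suc n * 2 + suc (suc n * n) ≤⟨ ℕ.+-monoʳ-≤ (suc n * 2) large ⟩
  suc n * 2 + m               ≤⟨ bound ⟩
  suc n * suc n + 4           ≡⟨ cong (_+ 4) (ℕ.*-suc (suc n) n) ⟩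
  suc n + suc n * n + 4       ∎))
  where
  open ℕ.≤-Reasoning
  expand-lhs : ∀ n → suc n + suc n * n + (2 + n) ≡ suc n * 2 + suc (suc n * n)
  expand-lhs = solve-∀

almost-full-row-exists : ∀ {N} (J : Subset² N) → 4 ≤ N → N * (N ∸ 1) < card J → (a : Fin N) →
  ∃ λ c → c ≢ a × c ≢ opposite a × AtMostOneHole (J c)
almost-full-row-exists {suc n} J (s≤s 3≤n) large a
  with any? (λ c → ¬? (c ≟F a) ×-dec ¬? (c ≟F opposite a) ×-dec ¬? (twoHoles? (J c)))
... | yes (c , c≢a , c≢a′ , ¬two) = c , c≢a , c≢a′ , ¬twoHoles⇒atMostOneHole (J c) ¬two
... | no ∄c = contradiction card-bound (too-many-cells n (card J) 3≤n large)
  where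
  open ℕ.≤-Reasoning
  N = suc n
  δ₂ : Fin N → Fin N → ℕ
  δ₂ x c = if does (x ≟F c) then 2 else 0
  spare : Fin N → ℕ
  spare c = δ₂ a c + δ₂ (opposite a) c
  two+row≤N+2 : ∀ c → 2 + rowCount (J c) ≤ N + 2
  two+row≤N+2 c = ℕ.≤-trans (ℕ.+-monoʳ-≤ 2 (rowCount-≤ (J c))) (ℕ.≤-reflexive (ℕ.+-comm 2 N))
  row-bound : ∀ c → 2 + rowCount (J c) ≤ N + spare c
  row-bound c with a ≟F c | opposite a ≟F c
  ... | yes _  | _       = ℕ.≤-trans (two+row≤N+2 c) (ℕ.+-monoʳ-≤ N (ℕ.m≤m+n 2 _))
  ... | no _   | yes _   = two+row≤N+2 c
  ... | no a≢c | no a′≢c with twoHoles? (J c)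
  ...   | yes (j , j′ , j≢j′ , Jcj≡false , Jcj′≡false) =
          ℕ.≤-trans (rowCount-two-holes (J c) j≢j′ Jcj≡false Jcj′≡false) (ℕ.m≤m+n N 0)
  ...   | no ¬two = contradiction (c , a≢c ∘ sym , a′≢c ∘ sym , ¬two) ∄c
  card-bound : N * 2 + card J ≤ N * N + 4
  card-bound = begin
    N * 2 + card J                   ≡⟨ cong (_+ card J) (Σℕ-const N 2) ⟨
    Σℕ {N} (λ _ → 2) + card J        ≡⟨ Σℕ-distrib-+ (λ _ → 2) (rowCount ∘ J) ⟨
    Σℕ (λ c → 2 + rowCount (J c))    ≤⟨ Σℕ-mono-≤ row-bound ⟩
    Σℕ (λ c → N + spare c)           ≡⟨ Σℕ-distrib-+ (λ _ → N) spare ⟩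
    Σℕ {N} (λ _ → N) + Σℕ spare      ≡⟨ cong₂ _+_ (Σℕ-const N N) (trans (Σℕ-distrib-+ (δ₂ a) (δ₂ (opposite a)))
                                          (cong₂ _+_ (Σℕ-indicator a 2) (Σℕ-indicator (opposite a) 2))) ⟩
    N * N + 4                        ∎

lemma7 : (N : ℕ) → 4 ≤ N → (J : Subset² N) → N * (N ∸ 1) < card J → E≡2 N J
lemma7 N 4≤N J large =
  let a , a-full = full-row-exists J large
      c , c≢a , c≢a′ , c-hole = almost-full-row-exists J 4≤N large a
  in E≡2-from-full-row J 4≤N a-full c≢a c≢a′ c-hole
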